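{- Let $\mathcal{L}$ be a choice logic. For every $\mathcal{L}$-formula $F$, $\mathrm{opt}_{\mathcal{L}}(F)<2^{(|F|^2)}$, where $|F|$ is the total number of occurrences of variables in $F$.
   Context: Let $\mathcal{U}$ be an infinite set of propositional variables. A choice logic $\mathcal{L}$ is given by a finite set $C_{\mathcal{L}}$ of binary connective symbols disjoint from $\{\neg,\wedge,\vee\}$ and for each $\circ\in C_{\mathcal{L}}$ an optionality function $\mathrm{opt}_\circ:\mathbb{N}^2\to\mathbb{N}$ with $\mathrm{opt}_\circ(k,\ell)\le(k+1)(\ell+1)$ for all $k,\ell\in\mathbb{N}$ (together with a degree function, irrelevant here). $\mathcal{L}$-formulas: every variable; $(\neg F)$; $(F\circ G)$ for $\circ\in\{\wedge,\vee\}\cup C_{\mathcal{L}}$. Optionality: $\mathrm{opt}_{\mathcal{L}}(a)=1$ for variables $a$, $\mathrm{opt}_{\mathcal{L}}(\neg F)=1$, $\mathrm{opt}_{\mathcal{L}}(F\wedge G)=\mathrm{opt}_{\mathcal{L}}(F\vee G)=\max(\mathrm{opt}_{\mathcal{L}}(F),\mathrm{opt}_{\mathcal{L}}(G))$, $\mathrm{opt}_{\mathcal{L}}(F\circ G)=\mathrm{opt}_\circ(\mathrm{opt}_{\mathcal{L}}(F),\mathrm{opt}_{\mathcal{L}}(G))$ for $\circ\in C_{\mathcal{L}}$. -}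

module Defs where

open import Data.Nat using (ℕ; suc; _*_; _≤_; _⊔_; _+_)
open import Data.Fin using (Fin)

-- A choice logic: a finite set of binary connective symbols (represented as
-- Fin numConn, hence automatically disjoint from ¬, ∧, ∨) together with an
-- optionality function for each, bounded by (k+1)(ℓ+1).
-- (The degree function is irrelevant for this statement and is omitted.)
record ChoiceLogic : Set where
  field
    numConn   : ℕ
    optConn   : Fin numConn → ℕ → ℕ → ℕ
    optBound  : ∀ (c : Fin numConn) (k l : ℕ) → optConn c k l ≤ suc k * suc l

open ChoiceLogic public

Var : Set
Var = ℕ

data Formula (L : ChoiceLogic) : Set where
  var  : Var → Formula L
  neg  : Formula L → Formula L
  conj : Formula L → Formula L → Formula L
  disj : Formula L → Formula L → Formula L
  conn : Fin (numConn L) → Formula L → Formula L → Formula L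

opt : (L : ChoiceLogic) → Formula L → ℕ
opt L (var a)      = 1
opt L (neg F)      = 1
opt L (conj F G)   = opt L F ⊔ opt L G
opt L (disj F G)   = opt L F ⊔ opt L G
opt L (conn c F G) = optConn L c (opt L F) (opt L G)

size : {L : ChoiceLogic} → Formula L → ℕ
size (var a)      = 1
size (neg F)      = size F
size (conj F G)   = size F + size G
size (disj F G)   = size F + size G
size (conn c F G) = size F + size G

-- Only a choice connective can increase optionality: with
-- k < 2^(m²) and ℓ < 2^(n²) for the subformulas of sizes m and n, its value is
-- at most (k+1)(ℓ+1) ≤ 2^(m² + n²), and m² + n² < (m+n)² because m, n ≥ 1.

module Submission where

open import Defs
open import Data.Nat using (_<_; _^_; _*_; _+_; _≤_; _⊔_; s≤s; z≤n)
open import Data.Nat.Properties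
open import Relation.Binary.PropositionalEquality using (_≡_; subst; sym)
open import Data.Nat.Tactic.RingSolver using (solve-∀)

size-positive : {L : ChoiceLogic} (F : Formula L) → 1 ≤ size F
size-positive (var a)      = s≤s z≤n
size-positive (neg F)      = size-positive F
size-positive (conj F G)   = ≤-trans (size-positive F) (m≤m+n _ _)
size-positive (disj F G)   = ≤-trans (size-positive F) (m≤m+n _ _)
size-positive (conn c F G) = ≤-trans (size-positive F) (m≤m+n _ _)

2^sq-mono-≤ : ∀ {m n} → m ≤ n → 2 ^ (m * m) ≤ 2 ^ (n * n)
2^sq-mono-≤ m≤n = ^-monoʳ-≤ 2 (*-mono-≤ m≤n m≤n)

square-+-expand : ∀ m n → (m + n) * (m + n) ≡ (m * m + n * n) + 2 * (m * n)
square-+-expand = solve-∀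

square-superadditive : ∀ {m n} → 1 ≤ m → 1 ≤ n → m * m + n * n < (m + n) * (m + n)
square-superadditive {m} {n} 1≤m 1≤n =
  subst (m * m + n * n <_) (sym (square-+-expand m n))
    (m<m+n (m * m + n * n) (≤-trans (*-mono-≤ 1≤m 1≤n) (m≤m+n (m * n) _)))

2^sq-superadditive : ∀ {m n} → 1 ≤ m → 1 ≤ n →
                     2 ^ (m * m) * 2 ^ (n * n) < 2 ^ ((m + n) * (m + n))
2^sq-superadditive {m} {n} 1≤m 1≤n =
  subst (_< 2 ^ ((m + n) * (m + n))) (^-distribˡ-+-* 2 (m * m) (n * n))
    (^-monoʳ-< 2 (s≤s (s≤s z≤n)) (square-superadditive 1≤m 1≤n))

⊔-<-2^sq-+ : ∀ {a b} m n → a < 2 ^ (m * m) → b < 2 ^ (n * n) →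
             a ⊔ b < 2 ^ ((m + n) * (m + n))
⊔-<-2^sq-+ m n a< b< =
  ⊔-lub (≤-trans a< (2^sq-mono-≤ (m≤m+n m n))) (≤-trans b< (2^sq-mono-≤ (m≤n+m n m)))

suc*suc-<-2^sq-+ : ∀ {a b m n} → 1 ≤ m → 1 ≤ n → a < 2 ^ (m * m) → b < 2 ^ (n * n) →
                   (1 + a) * (1 + b) < 2 ^ ((m + n) * (m + n))
suc*suc-<-2^sq-+ 1≤m 1≤n a< b< = ≤-<-trans (*-mono-≤ a< b<) (2^sq-superadditive 1≤m 1≤n)

lemma7 : (L : ChoiceLogic) (F : Formula L) → opt L F < 2 ^ (size F * size F)
lemma7 L (var a)      = s≤s (s≤s z≤n)
lemma7 L (neg F)      = 2^sq-mono-≤ (size-positive F)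
lemma7 L (conj F G)   = ⊔-<-2^sq-+ (size F) (size G) (lemma7 L F) (lemma7 L G)
lemma7 L (disj F G)   = ⊔-<-2^sq-+ (size F) (size G) (lemma7 L F) (lemma7 L G)
lemma7 L (conn c F G) =
  ≤-<-trans (optBound L c (opt L F) (opt L G))
    (suc*suc-<-2^sq-+ (size-positive F) (size-positive G) (lemma7 L F) (lemma7 L G))
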